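{- Fix $k\ge 2$. The approximation ratio of the $k$-Opt algorithm for \textsc{Metric TSP} instances with $n$ vertices is monotonically non-decreasing in $n$.
   Context: A \textsc{Metric TSP} instance is a complete graph $K_n$ with nonnegative costs satisfying the triangle inequality; a tour is a Hamiltonian cycle. A $k$-move replaces at most $k$ edges of a tour by other edges to get a new tour; a tour is $k$-optimal if no $k$-move yields a shorter tour. The approximation ratio of $k$-Opt on $n$-vertex instances is the supremum over all $n$-vertex instances and all $k$-optimal tours $T$ of $c(T)/c(T^*)$, $T^*$ an optimal tour.
   Formalization: The costs of every Metric TSP instance take values in the nonnegative rationals, and the approximation ratio for each n is the supremum over such instances only. -}

module Defs where

open import Data.Nat as ℕ using (ℕ; zero; suc; _%_)
open import Data.Nat.DivMod using (m%n<n)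
open import Data.Fin using (Fin; toℕ; fromℕ<)
open import Data.List using (List; length; map; foldr; allFin)
open import Data.List.Membership.Propositional using (_∈_)
open import Data.Rational using (ℚ; 0ℚ; _+_; _*_; _≤_; _<_)
open import Data.Product using (Σ; ∃; _×_)
open import Data.Sum using (_⊎_)
open import Relation.Nullary using (¬_)
open import Relation.Binary.PropositionalEquality using (_≡_)
open import Function.Definitions using (Injective)

next : ∀ {n} → Fin n → Fin n
next {suc m} i = fromℕ< (m%n<n (suc (toℕ i)) (suc m))

-- A Metric TSP instance on the vertex set Fin n (complete graph K_n):
-- nonnegative symmetric costs satisfying the triangle inequality
-- (diagonal fixed to 0, it plays no role for tours).
record Instance (n : ℕ) : Set where
  field
    c        : Fin n → Fin n → ℚ
    nonneg   : ∀ u v → 0ℚ ≤ c u v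
    diag     : ∀ u → c u u ≡ 0ℚ
    symm     : ∀ u v → c u v ≡ c v u
    triangle : ∀ u v w → c u w ≤ c u v + c v w
open Instance public

-- A tour (Hamiltonian cycle of K_n) given by a visiting order π (a bijection
-- Fin n → Fin n; injectivity suffices on a finite set).  Its edges are
-- {π i , π (i+1 mod n)}.
Tour : ℕ → Set
Tour n = Σ (Fin n → Fin n) (Injective _≡_ _≡_)

order : ∀ {n} → Tour n → Fin n → Fin n
order (π Data.Product., _) = π

InTour : ∀ {n} → Tour n → Fin n → Fin n → Set
InTour T u v = ∃ λ i → (order T i ≡ u × order T (next i) ≡ v)
                     ⊎ (order T i ≡ v × order T (next i) ≡ u)

sumℚ : List ℚ → ℚ
sumℚ = foldr _+_ 0ℚ

cost : ∀ {n} → Instance n → Tour n → ℚ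
cost {n} I T = sumℚ (map (λ i → c I (order T i) (order T (next i))) (allFin n))

KMove : ∀ {n} → ℕ → Tour n → Tour n → Set
KMove {n} k T T' = ∃ λ (S : List (Fin n)) → (length S ℕ.≤ k) ×
  (∀ i → ¬ (i ∈ S) → InTour T' (order T i) (order T (next i)))

KOptimal : ∀ {n} → ℕ → Instance n → Tour n → Set
KOptimal k I T = ∀ T' → KMove k T T' → ¬ (cost I T' < cost I T)

Optimal : ∀ {n} → Instance n → Tour n → Set
Optimal I T = ∀ T' → cost I T ≤ cost I T'

-- q is strictly below the approximation ratio of k-Opt on n-vertex instances,
-- i.e. some n-vertex instance has a k-optimal tour T and optimal tour T*
-- with c(T)/c(T*) > q (cross-multiplied).
RatioExceeds : ℕ → ℕ → ℚ → Set
RatioExceeds k n q = Σ (Instance n) λ I → Σ (Tour n) λ T → Σ (Tour n) λ T* →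
  KOptimal k I T × Optimal I T* × (q * cost I T* < cost I T)

-- Duplicate a vertex v of an instance on n vertices: the copy has distance 0 to v and
-- the same distances as v to everything else, which is again a metric instance on
-- n + 1 vertices.  Inserting the copy next to v in a tour costs nothing, and by the
-- triangle inequality shortcutting the copy out of any tour of the new instance does
-- not increase its cost.  Hence optimal tours extend to optimal tours with the same
-- cost, and an improving k-move of an extended k-optimal tour would shortcut to an
-- improving k-move of the original tour; so every ratio attained on n vertices is
-- attained on n + 1 vertices.
module Submission where

open import Defs
open import Data.Nat using (ℕ; zero; suc; _≤_; _<_; _%_; s≤s; s≤s⁻¹)
open import Data.Nat.Properties using (<-irrefl; <⇒≤)
open import Data.Nat.DivMod using (m<n⇒m%n≡m; n%n≡0)
open import Data.Nat.GeneralisedArithmetic using (fold; iterate; iterate-is-fold)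
open import Data.Fin using (Fin; zero; suc; toℕ; fromℕ; inject₁; punchOut; lift)
open import Data.Fin.Properties
  using (toℕ-injective; toℕ-fromℕ<; toℕ-fromℕ; toℕ<n; toℕ-inject₁; suc-injective;
         0≢1+n; any?; _≟_; punchOut-injective; injective⇒≤; lift-injective)
open import Data.Fin.Relation.Unary.Top using (view; ‵fromℕ; ‵inject₁)
open import Data.List using (map; tabulate)
open import Data.List.Properties using (map-tabulate; length-map)
open import Data.List.Membership.Propositional using (_∈_)
open import Data.List.Membership.Propositional.Properties using (∈-map⁺)
open import Data.Rational using (ℚ; 0ℚ; _+_; _*_) renaming (_≤_ to _≤ℚ_; _<_ to _<ℚ_)
import Data.Rational.Properties as ℚₚ
open import Algebra.Bundles using (CommutativeMonoid)
open import Algebra.Properties.CommutativeSemigroup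
  (CommutativeMonoid.commutativeSemigroup ℚₚ.+-0-commutativeMonoid) using (x∙yz≈zx∙y)
open import Algebra.Properties.Monoid.Sum ℚₚ.+-0-monoid using (sum; sum-init-last; sum-cong-≗)
open import Data.Product using (∃; _×_; _,_; proj₂; map₂)
open import Data.Sum using (_⊎_; inj₁; inj₂)
open import Data.Empty using (⊥-elim)
open import Function using (_∘_)
open import Function.Definitions using (Injective)
open import Relation.Nullary using (¬_; yes; no)
open import Relation.Binary.PropositionalEquality

private
  variable
    m n : ℕ

injective⇒surjective : {f : Fin n → Fin n} → Injective _≡_ _≡_ f → ∀ y → ∃ λ x → f x ≡ y
injective⇒surjective {zero}  f-inj ()
injective⇒surjective {suc n} {f} f-inj y with any? (λ x → f x ≟ y)
... | yes hit = hit
... | no miss = ⊥-elim (<-irrefl refl (injective⇒≤ f-avoiding-y-injective))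
  where
  f≢y : ∀ x → y ≢ f x
  f≢y x e = miss (x , sym e)
  f-avoiding-y : Fin (suc n) → Fin n
  f-avoiding-y x = punchOut (f≢y x)
  f-avoiding-y-injective : Injective _≡_ _≡_ f-avoiding-y
  f-avoiding-y-injective {x} {x′} = f-inj ∘ punchOut-injective (f≢y x) (f≢y x′)

toℕ-next : (i : Fin (suc m)) → toℕ i < m → toℕ (next i) ≡ suc (toℕ i)
toℕ-next i i<m = trans (toℕ-fromℕ< _) (m<n⇒m%n≡m (s≤s i<m))

next-inject₁ : (j : Fin m) → next (inject₁ j) ≡ suc j
next-inject₁ j = toℕ-injective (trans (toℕ-next (inject₁ j) j<m) (cong suc (toℕ-inject₁ j)))
  where j<m = subst (_< _) (sym (toℕ-inject₁ j)) (toℕ<n j)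

next-fromℕ : ∀ m → next (fromℕ m) ≡ zero
next-fromℕ m = toℕ-injective
  (trans (toℕ-fromℕ< _) (trans (cong (λ k → suc k % suc m) (toℕ-fromℕ m)) (n%n≡0 (suc m))))

next-suc-inject₁ : (j : Fin m) → next (suc (inject₁ j)) ≡ suc (next (inject₁ j))
next-suc-inject₁ j = trans (next-inject₁ (suc j)) (cong suc (sym (next-inject₁ j)))

next-injective : Injective _≡_ _≡_ (next {suc m})
next-injective {m} {i} {j} e with view i | view j
... | ‵fromℕ     | ‵fromℕ     = refl
... | ‵fromℕ     | ‵inject₁ j′ =
  ⊥-elim (0≢1+n (trans (sym (next-fromℕ m)) (trans e (next-inject₁ j′))))
... | ‵inject₁ i′ | ‵fromℕ     =
  ⊥-elim (0≢1+n (trans (sym (next-fromℕ m)) (trans (sym e) (next-inject₁ i′))))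
... | ‵inject₁ i′ | ‵inject₁ j′ =
  cong inject₁ (suc-injective (trans (sym (next-inject₁ i′)) (trans e (next-inject₁ j′))))

next-surjective : (i : Fin (suc m)) → ∃ λ j → next j ≡ i
next-surjective {m} zero = fromℕ m , next-fromℕ m
next-surjective (suc i) = inject₁ i , next-inject₁ i

toℕ-fold-next : ∀ t → t ≤ m → toℕ (fold {A = Fin (suc m)} zero next t) ≡ t
toℕ-fold-next zero    _   = refl
toℕ-fold-next (suc t) t<m =
  trans (toℕ-next _ (subst (_< _) (sym ih) t<m)) (cong suc ih)
  where ih = toℕ-fold-next t (<⇒≤ t<m)

iterate-next-toℕ : (j : Fin (suc m)) → iterate next zero (toℕ j) ≡ j
iterate-next-toℕ j = trans (sym (iterate-is-fold zero next (toℕ j)))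
                           (toℕ-injective (toℕ-fold-next (toℕ j) (s≤s⁻¹ (toℕ<n j))))

sumℚ-tabulate : (f : Fin n → ℚ) → sumℚ (tabulate f) ≡ sum f
sumℚ-tabulate {zero}  f = refl
sumℚ-tabulate {suc n} f = cong (f zero +_) (sumℚ-tabulate (f ∘ suc))

sum-next : (g : Fin (suc m) → ℚ) → sum (g ∘ next) ≡ sum g
sum-next {m} g = begin
  sum (g ∘ next)                         ≡⟨ sum-init-last (g ∘ next) ⟩
  sum (g ∘ next ∘ inject₁) + g (next (fromℕ m))
    ≡⟨ cong₂ _+_ (sum-cong-≗ (cong g ∘ next-inject₁)) (cong g (next-fromℕ m)) ⟩
  sum (g ∘ suc) + g zero                 ≡⟨ ℚₚ.+-comm (sum (g ∘ suc)) (g zero) ⟩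
  sum g                                  ∎
  where open ≡-Reasoning

cost≡sum : (I : Instance n) (T : Tour n) →
           cost I T ≡ sum (λ i → c I (order T i) (order T (next i)))
cost≡sum I T = trans (cong sumℚ (map-tabulate (λ i → i) edge)) (sumℚ-tabulate edge)
  where edge = λ i → c I (order T i) (order T (next i))

walk : {V : Set} → (V → V → ℚ) → (Fin (suc m) → V) → ℚ
walk {m} d φ = sum {m} (λ j → d (φ (inject₁ j)) (φ (suc j)))

cost≡walk+closing : (I : Instance (suc m)) (T : Tour (suc m)) →
  cost I T ≡ walk (c I) (order T) + c I (order T (fromℕ m)) (order T zero)
cost≡walk+closing {m} I T = begin
  cost I T                                         ≡⟨ cost≡sum I T ⟩
  sum edge                                         ≡⟨ sum-init-last edge ⟩
  sum (edge ∘ inject₁) + edge (fromℕ m)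
    ≡⟨ cong₂ _+_ (sum-cong-≗ (λ j → cong (c I (π (inject₁ j)) ∘ π) (next-inject₁ j)))
                 (cong (c I (π (fromℕ m)) ∘ π) (next-fromℕ m)) ⟩
  walk (c I) π + c I (π (fromℕ m)) (π zero)         ∎
  where
  open ≡-Reasoning
  π = order T
  edge = λ i → c I (π i) (π (next i))

rotate : Tour (suc m) → Tour (suc m)
rotate (π , π-inj) = π ∘ next , next-injective ∘ π-inj

order-fold-rotate : (R : Tour (suc m)) (t : ℕ) (i : Fin (suc m)) →
                    order (fold R rotate t) i ≡ order R (iterate next i t)
order-fold-rotate R zero    i = refl
order-fold-rotate R (suc t) i = order-fold-rotate R t (next i)

cost-rotate : (I : Instance (suc m)) (R : Tour (suc m)) → cost I (rotate R) ≡ cost I R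
cost-rotate I R = begin
  cost I (rotate R)    ≡⟨ cost≡sum I (rotate R) ⟩
  sum (edge ∘ next)    ≡⟨ sum-next edge ⟩
  sum edge             ≡⟨ sym (cost≡sum I R) ⟩
  cost I R             ∎
  where
  open ≡-Reasoning
  edge = λ i → c I (order R i) (order R (next i))

cost-fold-rotate : (I : Instance (suc m)) (R : Tour (suc m)) (t : ℕ) →
                   cost I (fold R rotate t) ≡ cost I R
cost-fold-rotate I R zero    = refl
cost-fold-rotate I R (suc t) = trans (cost-rotate I (fold R rotate t)) (cost-fold-rotate I R t)

InTour-rotate : (R : Tour (suc m)) {u w : Fin (suc m)} → InTour R u w → InTour (rotate R) u w
InTour-rotate R (i , edge) with next-surjective i
... | j , refl = j , edge

InTour-fold-rotate : (R : Tour (suc m)) (t : ℕ) {u w : Fin (suc m)} →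
                     InTour R u w → InTour (fold R rotate t) u w
InTour-fold-rotate R zero    = λ uw → uw
InTour-fold-rotate R (suc t) = InTour-rotate (fold R rotate t) ∘ InTour-fold-rotate R t

rotate-to-zero : (R : Tour (suc m)) (u : Fin (suc m)) → ∃ λ t → order (fold R rotate t) zero ≡ u
rotate-to-zero R u with injective⇒surjective (proj₂ R) u
... | j , πj≡u = toℕ j , trans (order-fold-rotate R (toℕ j) zero)
                               (trans (cong (order R) (iterate-next-toℕ j)) πj≡u)

InTour-sym : (T : Tour n) {u w : Fin n} → InTour T u w → InTour T w u
InTour-sym T (i , inj₁ edge) = i , inj₂ edge
InTour-sym T (i , inj₂ edge) = i , inj₁ edge

collapse : Fin n → Fin (suc n) → Fin n
collapse v zero    = v
collapse v (suc a) = a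

collapse-injective : {v : Fin n} {x y : Fin (suc n)} →
                     x ≢ zero → y ≢ zero → collapse v x ≡ collapse v y → x ≡ y
collapse-injective {x = zero}  x≢0 _   _   = ⊥-elim (x≢0 refl)
collapse-injective {y = zero}  _   y≢0 _   = ⊥-elim (y≢0 refl)
collapse-injective {x = suc a} {suc b} _ _ a≡b = cong suc a≡b

pullback : {n′ : ℕ} → (Fin n′ → Fin n) → Instance n → Instance n′
pullback f I = record
  { c        = λ x y → c I (f x) (f y)
  ; nonneg   = λ x y → nonneg I (f x) (f y)
  ; diag     = diag I ∘ f
  ; symm     = λ x y → symm I (f x) (f y)
  ; triangle = λ x y z → triangle I (f x) (f y) (f z)
  }

-- The new vertex is zero, a copy of v; the old vertex a becomes suc a.
duplicate : Instance n → Fin n → Instance (suc n)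
duplicate I v = pullback (collapse v) I

-- Visits the new vertex first, then the old vertices in the order of T.
extend : Tour n → Tour (suc n)
extend T = lift 1 (order T) , lift-injective (order T) (proj₂ T) 1

module Duplicate (I : Instance (suc m)) (v : Fin (suc m)) where

  I⁺ : Instance (suc (suc m))
  I⁺ = duplicate I v

  cost-extend : (T : Tour (suc m)) → order T zero ≡ v → cost I⁺ (extend T) ≡ cost I T
  cost-extend T π₀≡v = begin
    cost I⁺ (extend T)                          ≡⟨ cost≡walk+closing I⁺ (extend T) ⟩
    (c I v (π zero) + W) + c I (π (fromℕ m)) v
      ≡⟨ cong (λ x → (c I x (π zero) + W) + c I (π (fromℕ m)) x) (sym π₀≡v) ⟩
    (c I (π zero) (π zero) + W) + closing       ≡⟨ cong (λ x → (x + W) + closing) (diag I (π zero)) ⟩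
    (0ℚ + W) + closing                          ≡⟨ cong (_+ closing) (ℚₚ.+-identityˡ W) ⟩
    W + closing                                 ≡⟨ sym (cost≡walk+closing I T) ⟩
    cost I T                                    ∎
    where
    open ≡-Reasoning
    π = order T
    W = walk (c I) π
    closing = c I (π (fromℕ m)) (π zero)

  record IsShortcut (R : Tour (suc (suc m))) (S : Tour (suc m)) : Set where
    field
      cost-≤   : cost I S ≤ℚ cost I⁺ R
      old-edge : ∀ {a b} → InTour R (suc a) (suc b) → InTour S a b
      bridge   : ∀ {a b} → a ≢ b → InTour R (suc a) zero → InTour R zero (suc b) →
                 InTour S a b

  module _ (R : Tour (suc (suc m))) (ρ₀≡0 : order R zero ≡ zero) where

    private
      ρ : Fin (suc (suc m)) → Fin (suc (suc m))
      ρ = order R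

      ρ-suc≢0 : ∀ j → ρ (suc j) ≢ zero
      ρ-suc≢0 j e = 0≢1+n (sym (proj₂ R (trans e (sym ρ₀≡0))))

      σ : Fin (suc m) → Fin (suc m)
      σ j = collapse v (ρ (suc j))

    shortcut : Tour (suc m)
    shortcut = σ , λ e → suc-injective (proj₂ R (collapse-injective (ρ-suc≢0 _) (ρ-suc≢0 _) e))

    cost-shortcut : cost I shortcut ≤ℚ cost I⁺ R
    cost-shortcut = begin
      cost I shortcut                           ≡⟨ cost≡walk+closing I shortcut ⟩
      W + c I l (σ zero)                        ≤⟨ ℚₚ.+-monoʳ-≤ W (triangle I l v (σ zero)) ⟩
      W + (c I l v + c I v (σ zero))            ≡⟨ x∙yz≈zx∙y W (c I l v) (c I v (σ zero)) ⟩
      (c I v (σ zero) + W) + c I l v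
        ≡⟨ cong (λ x → (c I (collapse v x) (σ zero) + W) + c I l (collapse v x)) (sym ρ₀≡0) ⟩
      walk (c I⁺) ρ + c I⁺ (ρ (fromℕ (suc m))) (ρ zero) ≡⟨ sym (cost≡walk+closing I⁺ R) ⟩
      cost I⁺ R                                 ∎
      where
      open ℚₚ.≤-Reasoning
      W = walk (c I) σ
      l = σ (fromℕ m)

    old-step : ∀ i {a b} → ρ i ≡ suc a → ρ (next i) ≡ suc b →
               ∃ λ j → σ j ≡ a × σ (next j) ≡ b
    old-step zero ρi≡a _ = ⊥-elim (0≢1+n (trans (sym ρ₀≡0) ρi≡a))
    old-step (suc j) ρi≡a ρi⁺≡b with view j
    ... | ‵fromℕ =
      ⊥-elim (0≢1+n (trans (sym ρ₀≡0) (trans (cong ρ (sym (next-fromℕ (suc m)))) ρi⁺≡b)))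
    ... | ‵inject₁ j′ = inject₁ j′ , cong (collapse v) ρi≡a ,
          cong (collapse v) (trans (cong ρ (sym (next-suc-inject₁ j′))) ρi⁺≡b)

    shortcut-old-edge : ∀ {a b} → InTour R (suc a) (suc b) → InTour shortcut a b
    shortcut-old-edge (i , inj₁ (p , q)) = map₂ inj₁ (old-step i p q)
    shortcut-old-edge (i , inj₂ (p , q)) = map₂ inj₂ (old-step i p q)

    neighbour : ∀ {a} → InTour R (suc a) zero → σ (fromℕ m) ≡ a ⊎ σ zero ≡ a
    neighbour (i , inj₁ (ρi≡a , ρi⁺≡0))
      with next-injective {x = i} {y = fromℕ (suc m)}
             (trans (proj₂ R (trans ρi⁺≡0 (sym ρ₀≡0))) (sym (next-fromℕ (suc m))))
    ... | refl = inj₁ (cong (collapse v) ρi≡a)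
    neighbour (i , inj₂ (ρi≡0 , ρi⁺≡a)) with proj₂ R (trans ρi≡0 (sym ρ₀≡0))
    ... | refl = inj₂ (cong (collapse v) (trans (cong ρ (sym (next-inject₁ zero))) ρi⁺≡a))

    shortcut-bridge : ∀ {a b} → a ≢ b → InTour R (suc a) zero → InTour R zero (suc b) →
                      InTour shortcut a b
    shortcut-bridge a≢b a~0 0~b with neighbour a~0 | neighbour (InTour-sym R 0~b)
    ... | inj₁ σl≡a | inj₁ σl≡b = ⊥-elim (a≢b (trans (sym σl≡a) σl≡b))
    ... | inj₂ σ₀≡a | inj₂ σ₀≡b = ⊥-elim (a≢b (trans (sym σ₀≡a) σ₀≡b))
    ... | inj₁ σl≡a | inj₂ σ₀≡b = fromℕ m , inj₁ (σl≡a , trans (cong σ (next-fromℕ m)) σ₀≡b)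
    ... | inj₂ σ₀≡a | inj₁ σl≡b = fromℕ m , inj₂ (σl≡b , trans (cong σ (next-fromℕ m)) σ₀≡a)

    shortcut-isShortcut : IsShortcut R shortcut
    shortcut-isShortcut = record
      { cost-≤ = cost-shortcut ; old-edge = shortcut-old-edge ; bridge = shortcut-bridge }

  IsShortcut-rotate : {R : Tour (suc (suc m))} {S : Tour (suc m)} → ∀ t →
                      IsShortcut (fold R rotate t) S → IsShortcut R S
  IsShortcut-rotate {R} t sc = record
    { cost-≤   = ℚₚ.≤-trans cost-≤ (ℚₚ.≤-reflexive (cost-fold-rotate I⁺ R t))
    ; old-edge = old-edge ∘ InTour-fold-rotate R t
    ; bridge   = λ a≢b a~0 0~b → bridge a≢b (InTour-fold-rotate R t a~0) (InTour-fold-rotate R t 0~b)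
    }
    where open IsShortcut sc

  shortcut-exists : (R : Tour (suc (suc m))) → ∃ (IsShortcut R)
  shortcut-exists R with rotate-to-zero R zero
  ... | t , ρ₀≡0 = shortcut (fold R rotate t) ρ₀≡0 ,
                   IsShortcut-rotate t (shortcut-isShortcut (fold R rotate t) ρ₀≡0)

  -- Position i of T corresponds to position suc i of extend T, and the closing
  -- position fromℕ m to both edges through the new vertex (positions suc (fromℕ m) and zero).
  kMove-shortcut : {k : ℕ} {T : Tour (suc m)} {R : Tour (suc (suc m))} {S : Tour (suc m)} →
                   order T (fromℕ m) ≢ order T zero → IsShortcut R S →
                   KMove k (extend T) R → KMove k T S
  kMove-shortcut {k} {T} {R} {S} closing-not-loop sc (X , |X|≤k , keep) =
    map position X , subst (_≤ k) (sym (length-map position X)) |X|≤k , keep′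
    where
    open IsShortcut sc
    π = order T
    position = collapse (fromℕ m)
    kept : ∀ x → ¬ (position x ∈ map position X) → ¬ (x ∈ X)
    kept x x∉ x∈ = x∉ (∈-map⁺ position x∈)
    keep′ : ∀ i → ¬ (i ∈ map position X) → InTour S (π i) (π (next i))
    keep′ i i∉ with view i
    ... | ‵inject₁ j = old-edge
            (subst (InTour R (suc (π (inject₁ j)))) (cong (lift 1 π) (next-suc-inject₁ j))
                   (keep (suc (inject₁ j)) (kept _ i∉)))
    ... | ‵fromℕ = subst (InTour S (π (fromℕ m)) ∘ π) (sym (next-fromℕ m)) (bridge closing-not-loop
            (subst (InTour R (suc (π (fromℕ m)))) (cong (lift 1 π) (next-fromℕ (suc m)))
                   (keep (suc (fromℕ m)) (kept _ i∉)))
            (subst (InTour R zero) (cong (lift 1 π) (next-inject₁ zero)) (keep zero (kept _ i∉))))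

  optimal-extend : (T : Tour (suc m)) → order T zero ≡ v → Optimal I T → Optimal I⁺ (extend T)
  optimal-extend T π₀≡v opt R with shortcut-exists R
  ... | S , sc = begin
    cost I⁺ (extend T)   ≡⟨ cost-extend T π₀≡v ⟩
    cost I T             ≤⟨ opt S ⟩
    cost I S             ≤⟨ IsShortcut.cost-≤ sc ⟩
    cost I⁺ R            ∎
    where open ℚₚ.≤-Reasoning

  kOptimal-extend : {k : ℕ} (T : Tour (suc m)) → order T zero ≡ v →
                    order T (fromℕ m) ≢ order T zero → KOptimal k I T → KOptimal k I⁺ (extend T)
  kOptimal-extend {k} T π₀≡v closing-not-loop kopt R move improving with shortcut-exists R
  ... | S , sc = kopt S (kMove-shortcut {k} {T} closing-not-loop sc move) (begin-strict
    cost I S             ≤⟨ IsShortcut.cost-≤ sc ⟩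
    cost I⁺ R            <⟨ improving ⟩
    cost I⁺ (extend T)   ≡⟨ cost-extend T π₀≡v ⟩
    cost I T             ∎)
    where open ℚₚ.≤-Reasoning

ratioExceeds-suc : {k m : ℕ} {q : ℚ} →
                   RatioExceeds k (suc (suc m)) q → RatioExceeds k (suc (suc (suc m))) q
ratioExceeds-suc {k} {m} {q} (I , T , T* , kopt , opt , ratio) with rotate-to-zero T* (order T zero)
... | t , T*₀≡v = duplicate I v , extend T , extend T*₀ ,
                  kOptimal-extend T refl closing-not-loop kopt , optimal-extend T*₀ T*₀≡v opt₀ ,
                  subst₂ (λ x y → q * x <ℚ y)
                         (sym (trans (cost-extend T*₀ T*₀≡v) (cost-fold-rotate I T* t)))
                         (sym (cost-extend T refl)) ratio
  where
  v = order T zero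
  open Duplicate I v
  T*₀ = fold T* rotate t
  closing-not-loop : order T (fromℕ (suc m)) ≢ order T zero
  closing-not-loop e = 0≢1+n (sym (proj₂ T e))
  opt₀ : Optimal I T*₀
  opt₀ R = ℚₚ.≤-trans (ℚₚ.≤-reflexive (cost-fold-rotate I T* t)) (opt R)

-- The construction works for every k; only 2 ≤ n is needed.
lemma22 : (k : ℕ) → 2 ≤ k → (n : ℕ) → 3 ≤ n → (q : ℚ) →
          RatioExceeds k n q → RatioExceeds k (suc n) q
lemma22 k _ (suc (suc (suc m))) _ q = ratioExceeds-suc {q = q}
lemma22 k _ 1 (s≤s ())
lemma22 k _ 2 (s≤s (s≤s ()))
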